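{- Let $m$ be a positive integer, $\lambda\in\mathbb{R}$, and $n\ge 0$. Then for all $0\le k\le n$, $$V_{m,\lambda}^{(0)}(n,k)=m^{n-k}S_{1,\frac{\lambda}{m}}(n,k),\qquad W_{m,\lambda}^{(0)}(n,k)=m^{n-k}S_{2,\frac{\lambda}{m}}(n,k).$$
   Context: For $\lambda\in\mathbb{R}$, the generalized falling factorial is $(x)_{0,\lambda}=1$, $(x)_{n,\lambda}=x(x-\lambda)(x-2\lambda)\cdots(x-(n-1)\lambda)$ for $n\ge1$; $(x)_n=(x)_{n,1}$ is the ordinary falling factorial. The degenerate Stirling numbers of the first kind $S_{1,\lambda}(n,k)$ and of the second kind $S_{2,\lambda}(n,k)$ are defined by $(x)_n=\sum_{k=0}^n S_{1,\lambda}(n,k)(x)_{k,\lambda}$ and $(x)_{n,\lambda}=\sum_{k=0}^n S_{2,\lambda}(n,k)(x)_k$ (identities of polynomials in $x$). For a positive integer $m$ and a nonnegative integer $r$, the degenerate $r$-Whitney numbers of the second kind $W_{m,\lambda}^{(r)}(n,k)$ and of the first kind $V_{m,\lambda}^{(r)}(n,k)$ are defined by the polynomial identities $(mx+r)_{n,\lambda}=\sum_{k=0}^n W_{m,\lambda}^{(r)}(n,k)m^k(x)_k$ and $m^n(x)_n=\sum_{k=0}^n V_{m,\lambda}^{(r)}(n,k)(mx+r)_{k,\lambda}$, $n\ge0$. -}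

module Defs where

open import Level using (Level; suc; _⊔_)
open import Data.Nat using (ℕ) renaming (zero to zeroℕ; suc to sucℕ)
open import Data.Product using (∃)
open import Relation.Nullary using (¬_)
open import Algebra.Bundles using (CommutativeRing; Semiring)
import Algebra.Definitions.RawSemiring as RS

-- A field of characteristic zero (ℝ is the intended instance; the stdlib has no reals).
record CharZeroField (c ℓ : Level) : Set (suc (c ⊔ ℓ)) where
  field
    commutativeRing : CommutativeRing c ℓ
  open CommutativeRing commutativeRing public
  open RS (Semiring.rawSemiring semiring) public using (_×_; _^_)
  field
    0≉1      : ¬ (0# ≈ 1#)
    inverse  : ∀ x → ¬ (x ≈ 0#) → ∃ λ y → x * y ≈ 1#
    charZero : ∀ n → ¬ ((sucℕ n) × 1# ≈ 0#)

module _ {c ℓ : Level} (F : CharZeroField c ℓ) where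
  open CharZeroField F

  ff : Carrier → ℕ → Carrier → Carrier
  ff x zeroℕ    l = 1#
  ff x (sucℕ n) l = ff x n l * (x - (n × l))

  sumTo : ℕ → (ℕ → Carrier) → Carrier
  sumTo zeroℕ    f = f zeroℕ
  sumTo (sucℕ n) f = sumTo n f + f (sucℕ n)

-- The substitution x ↦ m x turns (x)_{n,λ/m} into m⁻ⁿ (m x)_{n,λ}, so the defining expansions
-- of V and W become the defining expansions of S₁ and S₂ rescaled by powers of m. Comparing
-- coefficients needs both {(x)_k} and {(x)_{k,μ}} to be linearly independent: the first by
-- evaluation at 0, 1, 2, …, the second because the two families are related by mutually
-- inverse triangular matrices.
module Submission where

open import Defs
open import Level using (_⊔_)
open import Data.Nat as ℕ using (ℕ; zero; suc; _≤_; _<_; _∸_; NonZero; z≤n; _≟_; _≤?_)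
import Data.Nat.Properties as ℕₚ
open import Data.Product using (_,_; ∃) renaming (_×_ to _∧_)
open import Data.Sum using (inj₁; inj₂)
open import Data.Empty using (⊥-elim)
open import Relation.Nullary using (¬_; yes; no)
import Relation.Binary.PropositionalEquality as ≡
open import Relation.Binary.Definitions using (tri<; tri≈; tri>)
import Algebra.Properties.Group as GroupProperties
import Algebra.Properties.AbelianGroup as AbelianGroupProperties
import Algebra.Properties.Ring as RingProperties
import Algebra.Properties.CommutativeSemigroup as CommutativeSemigroupProperties
import Algebra.Properties.Semiring.Mult as SemiringMultProperties
import Algebra.Properties.Semiring.Exp as SemiringExpProperties
import Algebra.Properties.Monoid.Mult as MonoidMultProperties

module FallingFactorials {c ℓ} (F : CharZeroField c ℓ) where
  open CharZeroField F hiding (zero)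
  open GroupProperties +-group using (x∙y⁻¹≈ε⇒x≈y; x≈y⇒x∙y⁻¹≈ε; //-rightDividesʳ)
  open AbelianGroupProperties +-abelianGroup using (⁻¹-∙-comm)
  open RingProperties ring using (x[y-z]≈xy-xz; [y-z]x≈yx-zx)
  open CommutativeSemigroupProperties *-commutativeSemigroup using (interchange; xy∙z≈xz∙y)
  open CommutativeSemigroupProperties +-commutativeSemigroup
    using () renaming (interchange to +-interchange)
  open SemiringMultProperties semiring using (×-comm-*)
  open SemiringExpProperties semiring using (^-homo-*; ^-congʳ)
  open MonoidMultProperties +-monoid using (×-homo-+; ×-congˡ; ×-congʳ)
  open import Relation.Binary.Reasoning.Setoid setoid

  *-cancelʳ : ∀ {a b d} → ¬ b ≈ 0# → a * b ≈ d * b → a ≈ d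
  *-cancelʳ {a} {b} {d} b≉0 ab≈db with inverse b b≉0
  ... | b⁻¹ , bb⁻¹≈1 = begin
    a             ≈⟨ *-identityʳ a ⟨
    a * 1#        ≈⟨ *-congˡ bb⁻¹≈1 ⟨
    a * (b * b⁻¹) ≈⟨ *-assoc a b b⁻¹ ⟨
    a * b * b⁻¹   ≈⟨ *-congʳ ab≈db ⟩
    d * b * b⁻¹   ≈⟨ *-assoc d b b⁻¹ ⟩
    d * (b * b⁻¹) ≈⟨ *-congˡ bb⁻¹≈1 ⟩
    d * 1#        ≈⟨ *-identityʳ d ⟩
    d             ∎

  x*y≈0⇒x≈0 : ∀ {x y} → ¬ y ≈ 0# → x * y ≈ 0# → x ≈ 0#
  x*y≈0⇒x≈0 {y = y} y≉0 xy≈0 = *-cancelʳ y≉0 (trans xy≈0 (sym (zeroˡ y)))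

  *-nonzero : ∀ {x y} → ¬ x ≈ 0# → ¬ y ≈ 0# → ¬ x * y ≈ 0#
  *-nonzero x≉0 y≉0 xy≈0 = x≉0 (x*y≈0⇒x≈0 y≉0 xy≈0)

  ×1-nonzero : ∀ m → .{{NonZero m}} → ¬ m × 1# ≈ 0#
  ×1-nonzero (suc m) = charZero m

  ×1-∸ : ∀ {i j} → i ≤ j → j × 1# - i × 1# ≈ (j ∸ i) × 1#
  ×1-∸ {i} {j} i≤j = begin
    j × 1# - i × 1#                ≈⟨ +-congʳ (×-congˡ (ℕₚ.m∸n+n≡m i≤j)) ⟨
    (j ∸ i ℕ.+ i) × 1# - i × 1#    ≈⟨ +-congʳ (×-homo-+ 1# (j ∸ i) i) ⟩
    (j ∸ i) × 1# + i × 1# - i × 1# ≈⟨ //-rightDividesʳ (i × 1#) ((j ∸ i) × 1#) ⟩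
    (j ∸ i) × 1#                   ∎

  a*xᵏ≈xⁿ*s⇒a≈xⁿ⁻ᵏ*s : ∀ {a x s} n k → k ≤ n → ¬ x ≈ 0# →
                        a * x ^ k ≈ x ^ n * s → a ≈ x ^ (n ∸ k) * s
  a*xᵏ≈xⁿ*s⇒a≈xⁿ⁻ᵏ*s {a} {x} {s} n k k≤n x≉0 axᵏ≈xⁿs = *-cancelʳ (xᵏ-nonzero k) (begin
    a * x ^ k               ≈⟨ axᵏ≈xⁿs ⟩
    x ^ n * s               ≈⟨ *-congʳ (^-congʳ x (≡.sym (ℕₚ.m∸n+n≡m k≤n))) ⟩
    x ^ (n ∸ k ℕ.+ k) * s   ≈⟨ *-congʳ (^-homo-* x (n ∸ k) k) ⟩
    x ^ (n ∸ k) * x ^ k * s ≈⟨ xy∙z≈xz∙y _ _ _ ⟩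
    x ^ (n ∸ k) * s * x ^ k ∎)
    where
    xᵏ-nonzero : ∀ k → ¬ x ^ k ≈ 0#
    xᵏ-nonzero zero    1≈0 = 0≉1 (sym 1≈0)
    xᵏ-nonzero (suc k)     = *-nonzero x≉0 (xᵏ-nonzero k)

  ∑ : ℕ → (ℕ → Carrier) → Carrier
  ∑ = sumTo F

  ∑-cong : ∀ n {f g : ℕ → Carrier} → (∀ k → k ≤ n → f k ≈ g k) → ∑ n f ≈ ∑ n g
  ∑-cong zero    f≈g = f≈g 0 z≤n
  ∑-cong (suc n) f≈g =
    +-cong (∑-cong n (λ k k≤n → f≈g k (ℕₚ.m≤n⇒m≤1+n k≤n))) (f≈g (suc n) ℕₚ.≤-refl)

  ∑-zero : ∀ n {f : ℕ → Carrier} → (∀ k → k ≤ n → f k ≈ 0#) → ∑ n f ≈ 0#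
  ∑-zero n f≈0 = trans (∑-cong n f≈0) (∑-0 n)
    where
    ∑-0 : ∀ n → ∑ n (λ _ → 0#) ≈ 0#
    ∑-0 zero    = refl
    ∑-0 (suc n) = trans (+-identityʳ _) (∑-0 n)

  ∑-single : ∀ n j {f : ℕ → Carrier} → j ≤ n →
             (∀ k → k ≤ n → k ≡.≢ j → f k ≈ 0#) → ∑ n f ≈ f j
  ∑-single zero    _ z≤n   _      = refl
  ∑-single (suc n) j j≤1+n others with ℕₚ.m≤n⇒m<n∨m≡n j≤1+n
  ... | inj₂ ≡.refl =
    trans (+-congʳ (∑-zero n (λ k k≤n → others k (ℕₚ.m≤n⇒m≤1+n k≤n) (ℕₚ.<⇒≢ (ℕ.s≤s k≤n)))))
          (+-identityˡ _)
  ... | inj₁ j<1+n =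
    trans (+-cong (∑-single n j (ℕₚ.m<1+n⇒m≤n j<1+n) (λ k k≤n → others k (ℕₚ.m≤n⇒m≤1+n k≤n)))
                  (others (suc n) ℕₚ.≤-refl (λ 1+n≡j → ℕₚ.<⇒≢ j<1+n (≡.sym 1+n≡j))))
          (+-identityʳ _)

  ∑-distrib-+ : ∀ n (f g : ℕ → Carrier) → ∑ n (λ k → f k + g k) ≈ ∑ n f + ∑ n g
  ∑-distrib-+ zero    f g = refl
  ∑-distrib-+ (suc n) f g = trans (+-congʳ (∑-distrib-+ n f g)) (+-interchange _ _ _ _)

  ∑-distrib-− : ∀ n (f g : ℕ → Carrier) → ∑ n (λ k → f k - g k) ≈ ∑ n f - ∑ n g
  ∑-distrib-− zero    f g = refl
  ∑-distrib-− (suc n) f g = begin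
    ∑ n (λ k → f k - g k) + (f (suc n) - g (suc n)) ≈⟨ +-congʳ (∑-distrib-− n f g) ⟩
    (∑ n f - ∑ n g) + (f (suc n) - g (suc n))       ≈⟨ +-interchange _ _ _ _ ⟩
    (∑ n f + f (suc n)) + (- ∑ n g - g (suc n))     ≈⟨ +-congˡ (⁻¹-∙-comm _ _) ⟩
    ∑ (suc n) f - ∑ (suc n) g                       ∎

  ∑-*ˡ : ∀ n a (f : ℕ → Carrier) → a * ∑ n f ≈ ∑ n (λ k → a * f k)
  ∑-*ˡ zero    a f = refl
  ∑-*ˡ (suc n) a f = trans (distribˡ a _ _) (+-congʳ (∑-*ˡ n a f))

  δ : ℕ → ℕ → Carrier
  δ n k with k ≟ n
  ... | yes _ = 1#
  ... | no _  = 0#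

  δ-diagonal : ∀ n → δ n n ≈ 1#
  δ-diagonal n with n ≟ n
  ... | yes _  = refl
  ... | no n≢n = ⊥-elim (n≢n ≡.refl)

  ∑-δ : ∀ n (f : ℕ → Carrier) → ∑ n (λ k → δ n k * f k) ≈ f n
  ∑-δ n f =
    trans (∑-single n n ℕₚ.≤-refl off-diagonal) (trans (*-congʳ (δ-diagonal n)) (*-identityˡ _))
    where
    off-diagonal : ∀ k → k ≤ n → k ≡.≢ n → δ n k * f k ≈ 0#
    off-diagonal k _ k≢n with k ≟ n
    ... | yes k≡n = ⊥-elim (k≢n k≡n)
    ... | no _    = zeroˡ _

  truncate : ℕ → (ℕ → Carrier) → ℕ → Carrier
  truncate n b j with j ≤? n
  ... | yes _ = b j
  ... | no _  = 0#

  truncate-suc : ∀ n b → truncate n b (suc n) ≈ 0#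
  truncate-suc n b with suc n ≤? n
  ... | yes 1+n≤n = ⊥-elim (ℕₚ.1+n≰n 1+n≤n)
  ... | no _      = refl

  ∑-truncate : ∀ n b (f : ℕ → Carrier) →
               ∑ n (λ j → b j * f j) ≈ ∑ (suc n) (λ j → truncate n b j * f j)
  ∑-truncate n b f =
    sym (trans (+-cong (∑-cong n below) (trans (*-congʳ (truncate-suc n b)) (zeroˡ _))) (+-identityʳ _))
    where
    below : ∀ j → j ≤ n → truncate n b j * f j ≈ b j * f j
    below j j≤n with j ≤? n
    ... | yes _   = refl
    ... | no j≰n = ⊥-elim (j≰n j≤n)

  LinearlyIndependent : (ℕ → Carrier → Carrier) → ℕ → Set (c ⊔ ℓ)
  LinearlyIndependent b n =
    ∀ (a : ℕ → Carrier) → (∀ x → ∑ n (λ k → a k * b k x) ≈ 0#) → ∀ k → k ≤ n → a k ≈ 0#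

  coefficients-unique : ∀ {b n} → LinearlyIndependent b n → ∀ (a a′ : ℕ → Carrier) →
                        (∀ x → ∑ n (λ k → a k * b k x) ≈ ∑ n (λ k → a′ k * b k x)) →
                        ∀ k → k ≤ n → a k ≈ a′ k
  coefficients-unique {b} {n} independent a a′ a·b≈a′·b k k≤n =
    x∙y⁻¹≈ε⇒x≈y _ _ (independent (λ k → a k - a′ k) difference k k≤n)
    where
    difference : ∀ x → ∑ n (λ k → (a k - a′ k) * b k x) ≈ 0#
    difference x = begin
      ∑ n (λ k → (a k - a′ k) * b k x)                   ≈⟨ ∑-cong n (λ k _ → [y-z]x≈yx-zx _ _ _) ⟩
      ∑ n (λ k → a k * b k x - a′ k * b k x)             ≈⟨ ∑-distrib-− n _ _ ⟩
      ∑ n (λ k → a k * b k x) - ∑ n (λ k → a′ k * b k x) ≈⟨ x≈y⇒x∙y⁻¹≈ε (a·b≈a′·b x) ⟩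
      0#                                                 ∎

  coefficients-rescale : ∀ {b n x} → LinearlyIndependent b n → ¬ x ≈ 0# → ∀ (a s : ℕ → Carrier) →
    (∀ y → ∑ n (λ k → (a k * x ^ k) * b k y) ≈ x ^ n * ∑ n (λ k → s k * b k y)) →
    ∀ k → k ≤ n → a k ≈ x ^ (n ∸ k) * s k
  coefficients-rescale {b} {n} {x} independent x≉0 a s expansion k k≤n =
    a*xᵏ≈xⁿ*s⇒a≈xⁿ⁻ᵏ*s n k k≤n x≉0
      (coefficients-unique independent _ (λ k → x ^ n * s k) expansion′ k k≤n)
    where
    expansion′ : ∀ y → ∑ n (λ k → (a k * x ^ k) * b k y) ≈ ∑ n (λ k → (x ^ n * s k) * b k y)
    expansion′ y =
      trans (expansion y) (trans (∑-*ˡ n _ _) (∑-cong n (λ k _ → sym (*-assoc _ _ _))))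

  ffBasis : Carrier → ℕ → Carrier → Carrier
  ffBasis l k x = ff F x k l

  ff-cong : ∀ k {x y l l′} → x ≈ y → l ≈ l′ → ff F x k l ≈ ff F y k l′
  ff-cong zero    _   _    = refl
  ff-cong (suc k) x≈y l≈l′ = *-cong (ff-cong k x≈y l≈l′) (+-cong x≈y (-‿cong (×-congʳ k l≈l′)))

  ff-scale : ∀ a x l k → ff F (a * x) k (a * l) ≈ a ^ k * ff F x k l
  ff-scale a x l zero    = sym (*-identityʳ 1#)
  ff-scale a x l (suc k) = begin
    ff F (a * x) k (a * l) * (a * x - k × (a * l)) ≈⟨ *-cong (ff-scale a x l k) factor ⟩
    a ^ k * ff F x k l * (a * (x - k × l))         ≈⟨ interchange _ _ _ _ ⟩
    a ^ k * a * (ff F x k l * (x - k × l))         ≈⟨ *-congʳ (*-comm _ _) ⟩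
    a ^ suc k * ff F x (suc k) l                   ∎
    where
    factor : a * x - k × (a * l) ≈ a * (x - k × l)
    factor = trans (+-congˡ (-‿cong (sym (×-comm-* k a l)))) (sym (x[y-z]≈xy-xz a x (k × l)))

  ff-vanishes : ∀ {j k} → j < k → ff F (j × 1#) k 1# ≈ 0#
  ff-vanishes {j} {suc k} j<1+k with ℕₚ.m<1+n⇒m<n∨m≡n j<1+k
  ... | inj₁ j<k    = trans (*-congʳ (ff-vanishes j<k)) (zeroˡ _)
  ... | inj₂ ≡.refl = trans (*-congˡ (-‿inverseʳ (j × 1#))) (zeroʳ _)

  ff-nonvanishing : ∀ {i j} → i ≤ j → ¬ ff F (j × 1#) i 1# ≈ 0#
  ff-nonvanishing {zero}      _   1≈0 = 0≉1 (sym 1≈0)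
  ff-nonvanishing {suc i} {j} i<j     = *-nonzero (ff-nonvanishing (ℕₚ.<⇒≤ i<j)) factor-nonzero
    where
    factor-nonzero : ¬ j × 1# - i × 1# ≈ 0#
    factor-nonzero factor≈0 = ×1-nonzero (j ∸ i) {{ℕ.>-nonZero (ℕₚ.m<n⇒0<n∸m i<j)}}
      (trans (sym (×1-∸ (ℕₚ.<⇒≤ i<j))) factor≈0)

  ffBasis-1-independent : ∀ n → LinearlyIndependent (ffBasis 1#) n
  ffBasis-1-independent n a a·ff≈0 k k≤n = coefficient k k≤n (below k k≤n)
    where
    -- evaluating at x = j kills the terms above j; those below j vanish by induction
    coefficient : ∀ j → j ≤ n → (∀ i → i < j → a i ≈ 0#) → a j ≈ 0#
    coefficient j j≤n lower≈0 = x*y≈0⇒x≈0 (ff-nonvanishing {j} ℕₚ.≤-refl)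
      (trans (sym (∑-single n j j≤n others)) (a·ff≈0 (j × 1#)))
      where
      others : ∀ i → i ≤ n → i ≡.≢ j → a i * ff F (j × 1#) i 1# ≈ 0#
      others i _ i≢j with ℕₚ.<-cmp i j
      ... | tri< i<j _ _ = trans (*-congʳ (lower≈0 i i<j)) (zeroˡ _)
      ... | tri≈ _ i≡j _ = ⊥-elim (i≢j i≡j)
      ... | tri> _ _ j<i = trans (*-congˡ (ff-vanishes j<i)) (zeroʳ _)
    below : ∀ j → j ≤ n → ∀ i → i < j → a i ≈ 0#
    below (suc j) j<n i i<1+j with ℕₚ.m<1+n⇒m<n∨m≡n i<1+j
    ... | inj₁ i<j    = below j (ℕₚ.<⇒≤ j<n) i i<j
    ... | inj₂ ≡.refl = coefficient i (ℕₚ.<⇒≤ j<n) (below i (ℕₚ.<⇒≤ j<n))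

  module ChangeOfBasis (f g : ℕ → Carrier → Carrier) (A B : ℕ → ℕ → Carrier)
    (f-in-g : ∀ n x → f n x ≈ ∑ n (λ k → A n k * g k x))
    (g-in-f : ∀ n x → g n x ≈ ∑ n (λ k → B n k * f k x))
    (f-independent : ∀ n → LinearlyIndependent f n) where

    rebase : ∀ n (a : ℕ → Carrier) → ∃ λ b → (∀ x → ∑ n (λ k → a k * g k x) ≈ ∑ n (λ j → b j * f j x))
                           ∧ b n ≈ a n * B n n
    rebase zero a =
      (λ j → a 0 * B 0 j) , (λ x → trans (*-congˡ (g-in-f 0 x)) (sym (*-assoc _ _ _))) , refl
    rebase (suc n) a with rebase n a
    ... | b , a·g≈b·f , _ = b′ , a·g≈b′·f , trans (+-congʳ (truncate-suc n b)) (+-identityˡ _)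
      where
      b′ : ℕ → Carrier
      b′ j = truncate n b j + a (suc n) * B (suc n) j
      a·g≈b′·f : ∀ x → ∑ (suc n) (λ k → a k * g k x) ≈ ∑ (suc n) (λ j → b′ j * f j x)
      a·g≈b′·f x = begin
        ∑ n (λ k → a k * g k x) + a (suc n) * g (suc n) x
          ≈⟨ +-cong (trans (a·g≈b·f x) (∑-truncate n b _)) (*-congˡ (g-in-f (suc n) x)) ⟩
        ∑ (suc n) (λ j → truncate n b j * f j x) + a (suc n) * ∑ (suc n) (λ j → B (suc n) j * f j x)
          ≈⟨ +-congˡ (∑-*ˡ (suc n) _ _) ⟩
        ∑ (suc n) (λ j → truncate n b j * f j x) + ∑ (suc n) (λ j → a (suc n) * (B (suc n) j * f j x))
          ≈⟨ ∑-distrib-+ (suc n) _ _ ⟨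
        ∑ (suc n) (λ j → truncate n b j * f j x + a (suc n) * (B (suc n) j * f j x))
          ≈⟨ ∑-cong (suc n) (λ j _ → trans (+-congˡ (sym (*-assoc _ _ _))) (sym (distribʳ _ _ _))) ⟩
        ∑ (suc n) (λ j → b′ j * f j x)
          ∎

    diagonal-inverse : ∀ n → A n n * B n n ≈ 1#
    diagonal-inverse n with rebase n (A n)
    ... | b , A·g≈b·f , bₙ≈AB = trans (sym bₙ≈AB)
      (trans (sym (coefficients-unique (f-independent n) (δ n) b δ·f≈b·f n ℕₚ.≤-refl)) (δ-diagonal n))
      where
      δ·f≈b·f : ∀ x → ∑ n (λ k → δ n k * f k x) ≈ ∑ n (λ j → b j * f j x)
      δ·f≈b·f x = trans (∑-δ n _) (trans (f-in-g n x) (A·g≈b·f x))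

    B-diagonal-nonzero : ∀ n → ¬ B n n ≈ 0#
    B-diagonal-nonzero n Bₙₙ≈0 =
      0≉1 (trans (sym (trans (*-congˡ Bₙₙ≈0) (zeroʳ _))) (diagonal-inverse n))

    leading-coefficient-zero : ∀ n (a : ℕ → Carrier) → (∀ x → ∑ n (λ k → a k * g k x) ≈ 0#) → a n ≈ 0#
    leading-coefficient-zero n a a·g≈0 with rebase n a
    ... | b , a·g≈b·f , bₙ≈aB = x*y≈0⇒x≈0 (B-diagonal-nonzero n)
      (trans (sym bₙ≈aB) (f-independent n b (λ x → trans (sym (a·g≈b·f x)) (a·g≈0 x)) n ℕₚ.≤-refl))

    g-independent : ∀ n → LinearlyIndependent g n
    g-independent zero    a a·g≈0 _ z≤n = leading-coefficient-zero 0 a a·g≈0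
    g-independent (suc n) a a·g≈0 k k≤1+n with ℕₚ.m≤n⇒m<n∨m≡n k≤1+n
    ... | inj₂ ≡.refl = leading-coefficient-zero (suc n) a a·g≈0
    ... | inj₁ k<1+n  = g-independent n a lower≈0 k (ℕₚ.m<1+n⇒m≤n k<1+n)
      where
      aₙ₊₁≈0 : a (suc n) ≈ 0#
      aₙ₊₁≈0 = leading-coefficient-zero (suc n) a a·g≈0
      lower≈0 : ∀ x → ∑ n (λ k → a k * g k x) ≈ 0#
      lower≈0 x = trans (sym (trans (+-congˡ (trans (*-congʳ aₙ₊₁≈0) (zeroˡ _))) (+-identityʳ _)))
                        (a·g≈0 x)

theorem1 : ∀ {c ℓ} (F : CharZeroField c ℓ) → let open CharZeroField F in
    (m : ℕ) → NonZero m →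
    (lam mu : Carrier) → (m × 1#) * mu ≈ lam →
    (S1 S2 V W : ℕ → ℕ → Carrier) →
    (∀ n x → ff F x n 1# ≈ sumTo F n (λ k → S1 n k * ff F x k mu)) →
    (∀ n x → ff F x n mu ≈ sumTo F n (λ k → S2 n k * ff F x k 1#)) →
    (∀ n x → ff F ((m × 1#) * x + (0 × 1#)) n lam
        ≈ sumTo F n (λ k → (W n k * ((m × 1#) ^ k)) * ff F x k 1#)) →
    (∀ n x → ((m × 1#) ^ n) * ff F x n 1#
        ≈ sumTo F n (λ k → V n k * ff F ((m × 1#) * x + (0 × 1#)) k lam)) →
    ∀ n k → k ≤ n →
      (V n k ≈ ((m × 1#) ^ (n ∸ k)) * S1 n k) ∧ (W n k ≈ ((m × 1#) ^ (n ∸ k)) * S2 n k)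
theorem1 F m m≢0 lam mu mμ≈λ S1 S2 V W ff-in-S1 ff-in-S2 ff-in-W ff-in-V n k k≤n =
  coefficients-rescale (g-independent n) M≉0 (V n) (S1 n) V-expansion k k≤n ,
  coefficients-rescale (ffBasis-1-independent n) M≉0 (W n) (S2 n) W-expansion k k≤n
  where
  open CharZeroField F hiding (zero)
  open FallingFactorials F
  open ChangeOfBasis (ffBasis 1#) (ffBasis mu) S1 S2 ff-in-S1 ff-in-S2 ffBasis-1-independent
  open import Relation.Binary.Reasoning.Setoid setoid
  M = m × 1#
  M≉0 = ×1-nonzero m {{m≢0}}
  scaled : ∀ k x → ff F (M * x + 0#) k lam ≈ M ^ k * ff F x k mu
  scaled k x = trans (ff-cong k (+-identityʳ _) (sym mμ≈λ)) (ff-scale M x mu k)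
  V-expansion : ∀ x → ∑ n (λ k → (V n k * M ^ k) * ff F x k mu) ≈ M ^ n * ∑ n (λ k → S1 n k * ff F x k mu)
  V-expansion x = begin
    ∑ n (λ k → (V n k * M ^ k) * ff F x k mu)   ≈⟨ ∑-cong n (λ k _ → trans (*-assoc _ _ _) (*-congˡ (sym (scaled k x)))) ⟩
    ∑ n (λ k → V n k * ff F (M * x + 0#) k lam) ≈⟨ ff-in-V n x ⟨
    M ^ n * ff F x n 1#                         ≈⟨ *-congˡ (ff-in-S1 n x) ⟩
    M ^ n * ∑ n (λ k → S1 n k * ff F x k mu)    ∎
  W-expansion : ∀ x → ∑ n (λ k → (W n k * M ^ k) * ff F x k 1#) ≈ M ^ n * ∑ n (λ k → S2 n k * ff F x k 1#)
  W-expansion x = begin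
    ∑ n (λ k → (W n k * M ^ k) * ff F x k 1#) ≈⟨ ff-in-W n x ⟨
    ff F (M * x + 0#) n lam                   ≈⟨ scaled n x ⟩
    M ^ n * ff F x n mu                       ≈⟨ *-congˡ (ff-in-S2 n x) ⟩
    M ^ n * ∑ n (λ k → S2 n k * ff F x k 1#)  ∎
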